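{- Let $q$ be a prime power and $m\ge2$, $t\ge2$ integers with $t>\frac{q^{2m}-q^{m+1}-q^m+2q-1}{q-1}$, and let $\varepsilon=(t-1)\bmod q$. Define $$R_2=q^{2m+t-1}\frac{q^m+q^{m+1}-t+q(t-3-\varepsilon)+(1+\varepsilon)^2}{(1+q^m(q+1)+q(t-3)-t+\varepsilon)(1+q^m(q+1)+q(t-2)-t+\varepsilon)}.$$ Then $R_2\le q^{t-1}$.
   Context: Setting: $\mathbf{n}=(2,1,\dots,1)$, $\mathbf{m}=(m,1,\dots,1)$ of length $t$, with the sum-rank metric. $R_2$ is the Ratio-Type eigenvalue upper bound on $A_q(\mathbf{n},\mathbf{m},3)$, and $q^{t-1}$ is the value of the Singleton bound for these parameters with $d=3$. -}

module Defs where

open import Data.Nat as ℕ using (ℕ; zero; suc; _%_; _∸_)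
open import Data.Nat.Primality using (Prime)
open import Data.Integer as ℤ using (ℤ; +_; -[1+_])
open import Data.Rational as ℚ using (ℚ; mkℚ; _÷_; 0ℚ)
open import Data.Product using (Σ; _×_)
open import Relation.Binary.PropositionalEquality using (_≡_)

IsPrimePower : ℕ → Set
IsPrimePower q = Σ ℕ λ p → Σ ℕ λ k → Prime p × (1 ℕ.≤ k) × (q ≡ p ℕ.^ k)

ℤ→ℚ : ℤ → ℚ
ℤ→ℚ z = z ℚ./ 1

ℕ→ℚ : ℕ → ℚ
ℕ→ℚ n = ℤ→ℚ (+ n)

-- total division on ℚ (x / 0 := 0); only ever used with nonzero divisors
_÷₀_ : ℚ → ℚ → ℚ
x ÷₀ mkℚ (+ zero) _ _ = 0ℚ
x ÷₀ r@(mkℚ (+ suc n) _ _) = x ÷ r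
x ÷₀ r@(mkℚ -[1+ n ] _ _) = x ÷ r

-- ε = (t - 1) mod q  (q = 0 never occurs since q is a prime power)
epsilon : ℕ → ℕ → ℕ
epsilon zero t = 0
epsilon (suc k) t = (t ∸ 1) % suc k

threshold : ℕ → ℕ → ℚ
threshold q m =
  ℤ→ℚ ((+ (q ℕ.^ (2 ℕ.* m))) ℤ.- (+ (q ℕ.^ (m ℕ.+ 1))) ℤ.- (+ (q ℕ.^ m))
        ℤ.+ (+ (2 ℕ.* q)) ℤ.- (+ 1))
  ÷₀ ℤ→ℚ ((+ q) ℤ.- (+ 1))

R₂ : ℕ → ℕ → ℕ → ℚ
R₂ q m t = ℕ→ℚ (q ℕ.^ (2 ℕ.* m ℕ.+ t ∸ 1)) ℚ.* (num ÷₀ (den₁ ℚ.* den₂))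
  where
  Q = + q
  T = + t
  E = + epsilon q t
  Qm = + (q ℕ.^ m)
  num = ℤ→ℚ (Qm ℤ.+ (+ (q ℕ.^ (m ℕ.+ 1))) ℤ.- T ℤ.+ Q ℤ.* (T ℤ.- + 3 ℤ.- E)
             ℤ.+ (+ 1 ℤ.+ E) ℤ.* (+ 1 ℤ.+ E))
  den₁ = ℤ→ℚ (+ 1 ℤ.+ Qm ℤ.* (Q ℤ.+ + 1) ℤ.+ Q ℤ.* (T ℤ.- + 3) ℤ.- T ℤ.+ E)
  den₂ = ℤ→ℚ (+ 1 ℤ.+ Qm ℤ.* (Q ℤ.+ + 1) ℤ.+ Q ℤ.* (T ℤ.- + 2) ℤ.- T ℤ.+ E)

{-# OPTIONS --safe #-}
module Submission where

-- Write q = 1 + ε + f, where f ≥ 0 as ε < q, and let r ≥ 0 be the slack of the hypothesis on t,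
-- t(q − 1) = q^{2m} − q^{m+1} − q^m + 2q + r.  Eliminating t, the factors of the denominator of R₂
-- become D₁ = q^{2m} − f + r and D₂ = D₁ + q, and its numerator becomes N = D₁ − εf, whence
-- D₁D₂ − q^{2m} N = D₁(1 + ε + r) + q^{2m} ε f ≥ 0.  As q^{2m+t−1} = q^{t−1} q^{2m}, this is R₂ ≤ q^{t−1}.

open import Defs
open import Data.Nat using (ℕ; _≤_; _∸_; _^_)
open import Data.Rational using (_<_) renaming (_≤_ to _≤ℚ_)

open import Data.Nat as ℕ using (suc; z≤n; s≤s)
import Data.Nat.Properties as ℕP
open import Data.Nat.DivMod using (m%n<n)
open import Data.Nat.Primality using (prime⇒nonZero; prime⇒nonTrivial)
open import Data.Nat.Coprimality as Coprime using (Coprime)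
open import Data.Integer as ℤ using (ℤ; +_; -[1+_]; +[1+_]; 0ℤ; +≤+; +<+)
import Data.Integer.Properties as ℤP
open import Data.Integer.Tactic.RingSolver using (solve-∀)
open import Data.Rational as ℚ using (mkℚ)
import Data.Rational.Properties as ℚP
open import Data.Product using (_×_; _,_; proj₁; proj₂)
open import Relation.Binary.PropositionalEquality

coprimeTo-1 : ∀ n → Coprime n 1
coprimeTo-1 n = Coprime.sym (Coprime.1-coprimeTo n)

ℤ→ℚ≡mkℚ : ∀ i → ℤ→ℚ i ≡ mkℚ i 0 (coprimeTo-1 ℤ.∣ i ∣)
ℤ→ℚ≡mkℚ (+ n)    = ℚP.normalize-coprime (coprimeTo-1 n)
ℤ→ℚ≡mkℚ -[1+ n ] = cong ℚ.-_ (ℚP.normalize-coprime (coprimeTo-1 (suc n)))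

ℤ→ℚ-* : ∀ i j → ℤ→ℚ (i ℤ.* j) ≡ ℤ→ℚ i ℚ.* ℤ→ℚ j
ℤ→ℚ-* i j rewrite ℤ→ℚ≡mkℚ i | ℤ→ℚ≡mkℚ j = refl

ℤ→ℚ-mono-≤ : ∀ {i j} → i ℤ.≤ j → ℤ→ℚ i ℚ.≤ ℤ→ℚ j
ℤ→ℚ-mono-≤ {i} {j} i≤j rewrite ℤ→ℚ≡mkℚ i | ℤ→ℚ≡mkℚ j =
  ℚ.*≤* (subst₂ ℤ._≤_ (sym (ℤP.*-identityʳ i)) (sym (ℤP.*-identityʳ j)) i≤j)

ℤ→ℚ-cancel-< : ∀ {i j} → ℤ→ℚ i ℚ.< ℤ→ℚ j → i ℤ.< j
ℤ→ℚ-cancel-< {i} {j} i<j rewrite ℤ→ℚ≡mkℚ i | ℤ→ℚ≡mkℚ j with i<j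
... | ℚ.*<* i*1<j*1 = subst₂ ℤ._<_ (ℤP.*-identityʳ i) (ℤP.*-identityʳ j) i*1<j*1

ℤ→ℚ-pos : ∀ n → ℚ.Positive (ℤ→ℚ +[1+ n ])
ℤ→ℚ-pos n rewrite ℤ→ℚ≡mkℚ +[1+ n ] = _

÷₀-*-cancel : ∀ x n → (x ÷₀ ℤ→ℚ +[1+ n ]) ℚ.* ℤ→ℚ +[1+ n ] ≡ x
÷₀-*-cancel x n rewrite ℤ→ℚ≡mkℚ +[1+ n ] = begin
  x ℚ.* ℚ.1/ d ℚ.* d    ≡⟨ ℚP.*-assoc x (ℚ.1/ d) d ⟩
  x ℚ.* (ℚ.1/ d ℚ.* d)  ≡⟨ cong (x ℚ.*_) (ℚP.*-inverseˡ d) ⟩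
  x ℚ.* ℚ.1ℚ            ≡⟨ ℚP.*-identityʳ x ⟩
  x                     ∎
  where
  open ≡-Reasoning
  d : ℚ.ℚ
  d = mkℚ +[1+ n ] 0 (coprimeTo-1 (suc n))

*-÷₀-≤ : ∀ i j n k → i ℤ.* j ℤ.≤ k ℤ.* +[1+ n ] →
         ℤ→ℚ i ℚ.* (ℤ→ℚ j ÷₀ ℤ→ℚ +[1+ n ]) ℚ.≤ ℤ→ℚ k
*-÷₀-≤ i j n k ij≤kd = ℚP.*-cancelʳ-≤-pos d {{ℤ→ℚ-pos n}} (begin
  (ℤ→ℚ i ℚ.* (ℤ→ℚ j ÷₀ d)) ℚ.* d  ≡⟨ ℚP.*-assoc (ℤ→ℚ i) _ d ⟩
  ℤ→ℚ i ℚ.* ((ℤ→ℚ j ÷₀ d) ℚ.* d)  ≡⟨ cong (ℤ→ℚ i ℚ.*_) (÷₀-*-cancel (ℤ→ℚ j) n) ⟩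
  ℤ→ℚ i ℚ.* ℤ→ℚ j                 ≡⟨ ℤ→ℚ-* i j ⟨
  ℤ→ℚ (i ℤ.* j)                   ≤⟨ ℤ→ℚ-mono-≤ ij≤kd ⟩
  ℤ→ℚ (k ℤ.* +[1+ n ])            ≡⟨ ℤ→ℚ-* k +[1+ n ] ⟩
  ℤ→ℚ k ℚ.* d                     ∎)
  where
  open ℚP.≤-Reasoning
  d : ℚ.ℚ
  d = ℤ→ℚ +[1+ n ]

*-÷₀*-≤ : ∀ i j d₁ d₂ k → 0ℤ ℤ.< d₁ → 0ℤ ℤ.< d₂ → i ℤ.* j ℤ.≤ k ℤ.* (d₁ ℤ.* d₂) →
          ℤ→ℚ i ℚ.* (ℤ→ℚ j ÷₀ (ℤ→ℚ d₁ ℚ.* ℤ→ℚ d₂)) ℚ.≤ ℤ→ℚ k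
*-÷₀*-≤ i j d₁@(+[1+ _ ]) d₂@(+[1+ _ ]) k _ _ ij≤kd rewrite sym (ℤ→ℚ-* d₁ d₂) =
  *-÷₀-≤ i j _ k ij≤kd
*-÷₀*-≤ i j (+ 0) d₂ k (+<+ ()) _ _
*-÷₀*-≤ i j d₁ (+ 0) k _ (+<+ ()) _

÷₀-<⇒< : ∀ i n j → ℤ→ℚ i ÷₀ ℤ→ℚ +[1+ n ] ℚ.< ℤ→ℚ j → i ℤ.< j ℤ.* +[1+ n ]
÷₀-<⇒< i n j i/d<j = ℤ→ℚ-cancel-< (subst₂ ℚ._<_ (÷₀-*-cancel (ℤ→ℚ i) n) (sym (ℤ→ℚ-* j +[1+ n ]))
  (ℚP.*-monoˡ-<-pos (ℤ→ℚ +[1+ n ]) {{ℤ→ℚ-pos n}} i/d<j))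

*-nonNeg : ∀ {i j} → 0ℤ ℤ.≤ i → 0ℤ ℤ.≤ j → 0ℤ ℤ.≤ i ℤ.* j
*-nonNeg {j = j} 0≤i 0≤j = ℤP.*-monoʳ-≤-nonNeg j {{ℤ.nonNegative 0≤j}} 0≤i

-- INLINE lets solve-∀, which does not unfold definitions, see through these abbreviations.
module _ where
  open import Data.Integer using (_+_; _*_; _-_)

  threshold-num : ℤ → ℤ → ℤ
  threshold-num Q A = A * A - A * Q - A + + 2 * Q - + 1
  {-# INLINE threshold-num #-}

  threshold-slack : ℤ → ℤ → ℤ → ℤ
  threshold-slack Q A T = T * (Q - + 1) - (+ 1 + threshold-num Q A)
  {-# INLINE threshold-slack #-}

  -- A′ stands for q^{m+1}, which R₂ writes as a power of its own.
  R₂-num : ℤ → ℤ → ℤ → ℤ → ℤ → ℤ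
  R₂-num Q A A′ T E = A + A′ - T + Q * (T - + 3 - E) + (+ 1 + E) * (+ 1 + E)
  {-# INLINE R₂-num #-}

  R₂-den₁ R₂-den₂ : ℤ → ℤ → ℤ → ℤ → ℤ
  R₂-den₁ Q A T E = + 1 + A * (Q + + 1) + Q * (T - + 3) - T + E
  R₂-den₂ Q A T E = + 1 + A * (Q + + 1) + Q * (T - + 2) - T + E
  {-# INLINE R₂-den₁ #-}
  {-# INLINE R₂-den₂ #-}

  R₂-den₁-slack : ∀ Q A T E → R₂-den₁ Q A T E ≡ + 1 + (A * A - Q + E + threshold-slack Q A T)
  R₂-den₁-slack = solve-∀

  R₂-den₂-den₁ : ∀ Q A T E → R₂-den₂ Q A T E ≡ R₂-den₁ Q A T E + Q
  R₂-den₂-den₁ = solve-∀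

  R₂-gap : ∀ Q A T E →
           R₂-den₁ Q A T E * R₂-den₂ Q A T E
             ≡ A * A * R₂-num Q A (A * Q) T E
               + (R₂-den₁ Q A T E * (+ 1 + E + threshold-slack Q A T) + A * A * (E * (Q - + 1 - E)))
  R₂-gap = solve-∀

  R₂-core : ∀ Q A T E → 0ℤ ℤ.≤ A → 0ℤ ℤ.≤ E → E ℤ.≤ Q - + 1 → Q ℤ.≤ A * A →
            threshold-num Q A ℤ.< T * (Q - + 1) →
            0ℤ ℤ.< R₂-den₁ Q A T E × 0ℤ ℤ.< R₂-den₂ Q A T E ×
            A * A * R₂-num Q A (A * Q) T E ℤ.≤ R₂-den₁ Q A T E * R₂-den₂ Q A T E
  R₂-core Q A T E 0≤A 0≤E E≤Q-1 Q≤A² thr = 0<D₁ , 0<D₂ , A²N≤D₁D₂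
    where
    open ℤP.≤-Reasoning
    D₁ D₂ R gap : ℤ
    D₁ = R₂-den₁ Q A T E
    D₂ = R₂-den₂ Q A T E
    R = threshold-slack Q A T
    gap = D₁ * (+ 1 + E + R) + A * A * (E * (Q - + 1 - E))

    0≤R : 0ℤ ℤ.≤ R
    0≤R = ℤP.i≤j⇒0≤j-i (ℤP.i<j⇒suc[i]≤j thr)

    0<D₁ : 0ℤ ℤ.< D₁
    0<D₁ = subst (0ℤ ℤ.<_) (sym (R₂-den₁-slack Q A T E))
      (ℤP.+-mono-<-≤ (+<+ (s≤s z≤n)) (ℤP.+-mono-≤ (ℤP.+-mono-≤ (ℤP.i≤j⇒0≤j-i Q≤A²) 0≤E) 0≤R))

    0<D₂ : 0ℤ ℤ.< D₂
    0<D₂ = subst (0ℤ ℤ.<_) (sym (R₂-den₂-den₁ Q A T E))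
      (ℤP.+-mono-<-≤ 0<D₁ (ℤP.≤-trans (ℤP.≤-trans 0≤E E≤Q-1) (ℤP.i-j≤i Q (+ 1))))

    0≤gap : 0ℤ ℤ.≤ gap
    0≤gap = ℤP.+-mono-≤
      (*-nonNeg (ℤP.<⇒≤ 0<D₁) (ℤP.+-mono-≤ (ℤP.+-mono-≤ (+≤+ z≤n) 0≤E) 0≤R))
      (*-nonNeg (*-nonNeg 0≤A 0≤A) (*-nonNeg 0≤E (ℤP.i≤j⇒0≤j-i E≤Q-1)))

    A²N≤D₁D₂ : A * A * R₂-num Q A (A * Q) T E ℤ.≤ D₁ * D₂
    A²N≤D₁D₂ = begin
      A * A * R₂-num Q A (A * Q) T E        ≤⟨ ℤP.i≤i+j _ gap {{ℤ.nonNegative 0≤gap}} ⟩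
      A * A * R₂-num Q A (A * Q) T E + gap  ≡⟨ R₂-gap Q A T E ⟨
      D₁ * D₂                                ∎

m≤m^n : ∀ m {n} .{{_ : ℕ.NonZero m}} → 1 ≤ n → m ≤ m ^ n
m≤m^n m {n} 1≤n = subst (_≤ m ^ n) (ℕP.*-identityʳ m) (ℕP.^-monoʳ-≤ m 1≤n)

m^[n+1]≡m^n*m : ∀ m n → m ^ (n ℕ.+ 1) ≡ m ^ n ℕ.* m
m^[n+1]≡m^n*m m n = trans (ℕP.^-distribˡ-+-* m n 1) (cong (m ^ n ℕ.*_) (ℕP.*-identityʳ m))

m^[2n]≡m^n*m^n : ∀ m n → m ^ (2 ℕ.* n) ≡ m ^ n ℕ.* m ^ n
m^[2n]≡m^n*m^n m n =
  trans (ℕP.^-distribˡ-+-* m n (n ℕ.+ 0)) (cong (λ k → m ^ n ℕ.* m ^ k) (ℕP.+-identityʳ n))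

m^[2n+t∸1]≡m^[t∸1]*m^[2n] : ∀ m n {t} → 1 ≤ t → m ^ (2 ℕ.* n ℕ.+ t ∸ 1) ≡ m ^ (t ∸ 1) ℕ.* m ^ (2 ℕ.* n)
m^[2n+t∸1]≡m^[t∸1]*m^[2n] m n {t} 1≤t = begin
  m ^ (2 ℕ.* n ℕ.+ t ∸ 1)          ≡⟨ cong (m ^_) (ℕP.+-∸-assoc (2 ℕ.* n) 1≤t) ⟩
  m ^ (2 ℕ.* n ℕ.+ (t ∸ 1))        ≡⟨ ℕP.^-distribˡ-+-* m (2 ℕ.* n) (t ∸ 1) ⟩
  m ^ (2 ℕ.* n) ℕ.* m ^ (t ∸ 1)    ≡⟨ ℕP.*-comm (m ^ (2 ℕ.* n)) (m ^ (t ∸ 1)) ⟩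
  m ^ (t ∸ 1) ℕ.* m ^ (2 ℕ.* n)    ∎
  where open ≡-Reasoning

+m^[n+1]≡+m^n*+m : ∀ m n → + (m ^ (n ℕ.+ 1)) ≡ + (m ^ n) ℤ.* + m
+m^[n+1]≡+m^n*+m m n = trans (cong +_ (m^[n+1]≡m^n*m m n)) (ℤP.pos-* (m ^ n) m)

+m^[2n]≡+m^n*+m^n : ∀ m n → + (m ^ (2 ℕ.* n)) ≡ + (m ^ n) ℤ.* + (m ^ n)
+m^[2n]≡+m^n*+m^n m n = trans (cong +_ (m^[2n]≡m^n*m^n m n)) (ℤP.pos-* (m ^ n) (m ^ n))

prime-power≥2 : ∀ {q} → IsPrimePower q → 2 ≤ q
prime-power≥2 (p , k , p-prime , 1≤k , refl) =
  ℕP.≤-trans (ℕ.nonTrivial⇒n>1 p {{prime⇒nonTrivial p-prime}}) (m≤m^n p {{prime⇒nonZero p-prime}} 1≤k)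

threshold<⇒threshold-num< : ∀ k m t → let q = suc (suc k) in threshold q m < ℕ→ℚ t →
                            threshold-num (+ q) (+ (q ^ m)) ℤ.< + t ℤ.* (+ q ℤ.- + 1)
threshold<⇒threshold-num< k m t thr =
  subst (ℤ._< + t ℤ.* +[1+ k ])
    (cong₂ (λ A² A′ → A² ℤ.- A′ ℤ.- A ℤ.+ + 2 ℤ.* + q ℤ.- + 1) (+m^[2n]≡+m^n*+m^n q m) (+m^[n+1]≡+m^n*+m q m))
    (÷₀-<⇒< (+ (q ^ (2 ℕ.* m)) ℤ.- + (q ^ (m ℕ.+ 1)) ℤ.- A ℤ.+ + (2 ℕ.* q) ℤ.- + 1) k (+ t) thr)
  where
  q : ℕ
  q = suc (suc k)
  A : ℤ
  A = + (q ^ m)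

R₂-bound : ∀ q m t → 2 ≤ q → 1 ≤ m → 1 ≤ t → threshold q m < ℕ→ℚ t → R₂ q m t ≤ℚ ℕ→ℚ (q ^ (t ∸ 1))
R₂-bound q@(suc (suc k)) m t (s≤s (s≤s z≤n)) 1≤m 1≤t thr =
  *-÷₀*-≤ (+ (q ^ (2 ℕ.* m ℕ.+ t ∸ 1))) N D₁ D₂ S 0<D₁ 0<D₂ bound
  where
  open ℤP.≤-Reasoning
  a : ℕ
  a = q ^ m
  Q A T E S N D₁ D₂ : ℤ
  Q = + q
  A = + a
  T = + t
  E = + epsilon q t
  S = + (q ^ (t ∸ 1))
  N = R₂-num Q A (+ (q ^ (m ℕ.+ 1))) T E
  D₁ = R₂-den₁ Q A T E
  D₂ = R₂-den₂ Q A T E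

  P≡ : + (q ^ (2 ℕ.* m ℕ.+ t ∸ 1)) ≡ S ℤ.* (A ℤ.* A)
  P≡ = trans (cong +_ (m^[2n+t∸1]≡m^[t∸1]*m^[2n] q m 1≤t))
         (trans (ℤP.pos-* (q ^ (t ∸ 1)) (q ^ (2 ℕ.* m))) (cong (S ℤ.*_) (+m^[2n]≡+m^n*+m^n q m)))

  E≤Q-1 : E ℤ.≤ Q ℤ.- + 1
  E≤Q-1 = +≤+ (ℕP.≤-pred (m%n<n (t ∸ 1) q))

  Q≤A² : Q ℤ.≤ A ℤ.* A
  Q≤A² = subst (Q ℤ.≤_) (ℤP.pos-* a a) (+≤+ (ℕP.≤-trans (m≤m^n q 1≤m) (ℕP.m≤m*n a a {{ℕP.m^n≢0 q m}})))

  core : 0ℤ ℤ.< D₁ × 0ℤ ℤ.< D₂ × A ℤ.* A ℤ.* R₂-num Q A (A ℤ.* Q) T E ℤ.≤ D₁ ℤ.* D₂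
  core = R₂-core Q A T E (+≤+ z≤n) (+≤+ z≤n) E≤Q-1 Q≤A² (threshold<⇒threshold-num< k m t thr)
  0<D₁ : 0ℤ ℤ.< D₁
  0<D₁ = proj₁ core
  0<D₂ : 0ℤ ℤ.< D₂
  0<D₂ = proj₁ (proj₂ core)

  bound : + (q ^ (2 ℕ.* m ℕ.+ t ∸ 1)) ℤ.* N ℤ.≤ S ℤ.* (D₁ ℤ.* D₂)
  bound = begin
    + (q ^ (2 ℕ.* m ℕ.+ t ∸ 1)) ℤ.* N             ≡⟨ cong₂ ℤ._*_ P≡ (cong (λ A′ → R₂-num Q A A′ T E) (+m^[n+1]≡+m^n*+m q m)) ⟩
    S ℤ.* (A ℤ.* A) ℤ.* R₂-num Q A (A ℤ.* Q) T E  ≡⟨ ℤP.*-assoc S (A ℤ.* A) _ ⟩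
    S ℤ.* (A ℤ.* A ℤ.* R₂-num Q A (A ℤ.* Q) T E)  ≤⟨ ℤP.*-monoˡ-≤-nonNeg S (proj₂ (proj₂ core)) ⟩
    S ℤ.* (D₁ ℤ.* D₂)                              ∎

lemma5p7 : (q m t : ℕ) → IsPrimePower q → 2 ≤ m → 2 ≤ t → threshold q m < ℕ→ℚ t → R₂ q m t ≤ℚ ℕ→ℚ (q ^ (t ∸ 1))
lemma5p7 q m t q-prime-power 2≤m 2≤t =
  R₂-bound q m t (prime-power≥2 q-prime-power) (ℕP.<⇒≤ 2≤m) (ℕP.<⇒≤ 2≤t)
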